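{- Let $\mathcal{S}$ be a set of sequents, $\Gamma_0$ a cedent and $\alpha_0$ a Harrop formula with $\mathcal{C}(\alpha_0)\subseteq\mathcal{S}$. If $\Gamma_0\Rightarrow\alpha_0$ is immediately derivable from $\mathcal{S}$, then $\mathcal{S}:\Gamma_0\,|\,\alpha_0$.
   Context: Formulas are propositional formulas built from atoms and $\bot$ with $\lor,\land,\supset$; a cedent is a finite set of formulas, a sequent $\Gamma\Rightarrow\alpha$ pairs a cedent with a formula. An occurrence of a subformula is strictly positive in $\alpha$ if it is $\alpha$ itself, or $\alpha$ is $\alpha_0\lor\alpha_1$ or $\alpha_0\land\alpha_1$ and it is strictly positive in some $\alpha_i$, or $\alpha$ is $\alpha_0\supset\alpha_1$ and it is strictly positive in $\alpha_1$. A Harrop formula has no strictly positive occurrence of a disjunction. For a set $\mathcal{S}$ of sequents, the sequents immediately derivable (i.d.) from $\mathcal{S}$ form the least set containing $\mathcal{S}$ and closed under: if $\Gamma\Rightarrow\beta$ and $\beta,\Delta\Rightarrow\alpha$ are i.d., then $\Gamma,\Delta\Rightarrow\alpha$ is i.d. $\mathcal{S}:\Gamma\,|\,\alpha$ holds iff $\Gamma\Rightarrow\alpha$ is i.d. from $\mathcal{S}$ and, inductively: $\alpha$ is an atom or $\bot$; or $\alpha\equiv\beta\supset\gamma$ and ($\mathcal{S}:\Gamma|\beta$ implies $\mathcal{S}:\Gamma|\gamma$); or $\alpha\equiv\beta_0\land\beta_1$ and $\mathcal{S}:\Gamma|\beta_i$ for both $i$; or $\alpha\equiv\beta_0\lor\beta_1$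 and $\mathcal{S}:\Gamma|\beta_i$ for some $i$. The set of sequents $\mathcal{C}(\gamma)$ is defined recursively: $\mathcal{C}(\gamma)=\emptyset$ if $\gamma$ is an atom, $\bot$, or a disjunction; $\mathcal{C}(\alpha\supset\beta)=\{\alpha,\alpha\supset\beta\Rightarrow\beta\}\cup\mathcal{C}(\beta)$; $\mathcal{C}(\alpha_0\land\alpha_1)=\{\alpha_0\land\alpha_1\Rightarrow\alpha_i:i=0,1\}\cup\mathcal{C}(\alpha_0)\cup\mathcal{C}(\alpha_1)$. -}

module Defs where

open import Data.Nat using (ℕ)
open import Data.List using (List; []; _∷_; _++_)
open import Data.List.Membership.Propositional using (_∈_)
open import Data.List.Relation.Unary.All using (All)
open import Data.Product using (Σ; _×_)
open import Data.Sum using (_⊎_)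
open import Data.Empty using (⊥)
open import Data.Unit using (⊤)
open import Relation.Nullary using (¬_)
open import Relation.Binary.PropositionalEquality using (_≡_)
open import Function.Bundles using (_⇔_)

infixr 30 _∧'_
infixr 25 _∨'_
infixr 20 _⊃_

data Formula : Set where
  atom : ℕ → Formula
  ⊥'   : Formula
  _∨'_ : Formula → Formula → Formula
  _∧'_ : Formula → Formula → Formula
  _⊃_  : Formula → Formula → Formula

data SP (φ : Formula) : Formula → Set where
  sp-here : SP φ φ
  sp-∨₀   : ∀ {α β} → SP φ α → SP φ (α ∨' β)
  sp-∨₁   : ∀ {α β} → SP φ β → SP φ (α ∨' β)
  sp-∧₀   : ∀ {α β} → SP φ α → SP φ (α ∧' β)
  sp-∧₁   : ∀ {α β} → SP φ β → SP φ (α ∧' β)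
  sp-⊃    : ∀ {α β} → SP φ β → SP φ (α ⊃ β)

Harrop : Formula → Set
Harrop α = ∀ φ ψ → ¬ SP (φ ∨' ψ) α

-- A cedent is a finite set of formulas, represented by a list
-- and compared extensionally (same elements).
Cedent : Set
Cedent = List Formula

_≈c_ : Cedent → Cedent → Set
Γ ≈c Δ = ∀ φ → (φ ∈ Γ) ⇔ (φ ∈ Δ)

record Sequent : Set where
  constructor _⇒_
  field
    ant : Cedent
    suc : Formula
open Sequent public

infix 15 _⇒_

_≈s_ : Sequent → Sequent → Set
(Γ ⇒ α) ≈s (Δ ⇒ β) = (Γ ≈c Δ) × (α ≡ β)

SeqSet : Set₁
SeqSet = Sequent → Set

_∈ₛ_ : Sequent → SeqSet → Set
s ∈ₛ 𝒮 = Σ Sequent λ s' → 𝒮 s' × (s ≈s s')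

-- Immediately derivable sequents: least set containing 𝒮 and closed under
-- cut: from Γ ⇒ β and β,Δ ⇒ α infer Γ,Δ ⇒ α (cedents are sets).
data ID (𝒮 : SeqSet) : Cedent → Formula → Set where
  id-base : ∀ {Γ α} → (Γ ⇒ α) ∈ₛ 𝒮 → ID 𝒮 Γ α
  id-cut  : ∀ {Γ Δ Σ' Θ β α} → ID 𝒮 Γ β → ID 𝒮 Σ' α →
            Σ' ≈c (β ∷ Δ) → Θ ≈c (Γ ++ Δ) → ID 𝒮 Θ α

Bar : SeqSet → Cedent → Formula → Set
Bar 𝒮 Γ α = ID 𝒮 Γ α × Bar' α
  where
  Bar' : Formula → Set
  Bar' (atom _)  = ⊤
  Bar' ⊥'        = ⊤
  Bar' (β ⊃ γ)   = Bar 𝒮 Γ β → Bar 𝒮 Γ γ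
  Bar' (β ∧' γ)  = Bar 𝒮 Γ β × Bar 𝒮 Γ γ
  Bar' (β ∨' γ)  = Bar 𝒮 Γ β ⊎ Bar 𝒮 Γ γ

𝒞 : Formula → List Sequent
𝒞 (atom _)  = []
𝒞 ⊥'        = []
𝒞 (_ ∨' _)  = []
𝒞 (α ⊃ β)   = ((α ∷ (α ⊃ β) ∷ []) ⇒ β) ∷ 𝒞 β
𝒞 (α₀ ∧' α₁) = (((α₀ ∧' α₁) ∷ []) ⇒ α₀) ∷ (((α₀ ∧' α₁) ∷ []) ⇒ α₁) ∷ (𝒞 α₀ ++ 𝒞 α₁)

_⊆ₛ_ : List Sequent → SeqSet → Set
L ⊆ₛ 𝒮 = All (λ s → s ∈ₛ 𝒮) L

module Submission where

-- Atoms and ⊥ need nothing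
-- beyond derivability; a disjunction is never Harrop.  For a conjunction
-- α₀ ∧ α₁ the projection sequents α₀ ∧ α₁ ⇒ αᵢ of 𝒞 are cut against
-- Γ ⇒ α₀ ∧ α₁, and for an implication α ⊃ β the modus-ponens sequent
-- α, α ⊃ β ⇒ β of 𝒞 is cut against Γ ⇒ α and Γ ⇒ α ⊃ β; in both cases the
-- induction hypothesis applies to the components, which are Harrop and
-- whose 𝒞-sets are contained in that of α₀.

open import Defs
open import Algebra.Bundles using (CommutativeMonoid)
open import Data.List using ([]; _∷_; _++_)
open import Data.List.Relation.Unary.All using (_∷_)
open import Data.List.Relation.Unary.All.Properties using (++⁻ˡ; ++⁻ʳ)
open import Data.List.Relation.Binary.BagAndSetEquality
  using (_∼[_]_; set; commutativeMonoid; ++-idempotent)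
open import Data.Product using (_,_; proj₁)
open import Data.Empty using (⊥-elim)
open import Data.Unit using (tt)
open import Relation.Nullary using (¬_)

private
  variable
    𝒮 : SeqSet
    Γ : Cedent
    α β γ : Formula

module CedentMonoid = CommutativeMonoid (commutativeMonoid set Formula)

asCedentEq : ∀ {Γ Δ} → Γ ∼[ set ] Δ → Γ ≈c Δ
asCedentEq Γ∼Δ φ = Γ∼Δ

cut₁ : ID 𝒮 Γ β → ID 𝒮 (β ∷ []) α → ID 𝒮 Γ α
cut₁ {Γ = Γ} Γ⇒β β⇒α =
  id-cut {Δ = []} Γ⇒β β⇒α (asCedentEq CedentMonoid.refl)
    (asCedentEq (CedentMonoid.sym (CedentMonoid.identityʳ Γ)))

-- Cut with a two-formula cedent: from Γ ⇒ β, Γ ⇒ γ and β, γ ⇒ α, infer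
-- Γ ⇒ α.  The two cuts produce the cedent Γ, Γ, which as a set is Γ.
cut₂ : ID 𝒮 Γ β → ID 𝒮 Γ γ → ID 𝒮 (β ∷ γ ∷ []) α → ID 𝒮 Γ α
cut₂ {Γ = Γ} {γ = γ} Γ⇒β Γ⇒γ βγ⇒α = id-cut {Δ = Γ} Γ⇒γ Γγ⇒α
    (asCedentEq (CedentMonoid.comm Γ (γ ∷ [])))
    (asCedentEq (CedentMonoid.sym (++-idempotent Γ)))
  where
  Γγ⇒α : ID _ (Γ ++ γ ∷ []) _
  Γγ⇒α = id-cut {Δ = γ ∷ []} Γ⇒β βγ⇒α
    (asCedentEq CedentMonoid.refl) (asCedentEq CedentMonoid.refl)

∨-not-Harrop : ¬ Harrop (α ∨' β)
∨-not-Harrop {α} {β} harrop = harrop α β sp-here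

Harrop-⊃ : Harrop (α ⊃ β) → Harrop β
Harrop-⊃ harrop φ ψ sp = harrop φ ψ (sp-⊃ sp)

Harrop-∧₀ : Harrop (α ∧' β) → Harrop α
Harrop-∧₀ harrop φ ψ sp = harrop φ ψ (sp-∧₀ sp)

Harrop-∧₁ : Harrop (α ∧' β) → Harrop β
Harrop-∧₁ harrop φ ψ sp = harrop φ ψ (sp-∧₁ sp)

proposition3p10 : (𝒮 : SeqSet) (Γ₀ : Cedent) (α₀ : Formula) →
    Harrop α₀ → 𝒞 α₀ ⊆ₛ 𝒮 → ID 𝒮 Γ₀ α₀ → Bar 𝒮 Γ₀ α₀
proposition3p10 𝒮 Γ (atom _) _ _ Γ⇒α₀ = Γ⇒α₀ , tt
proposition3p10 𝒮 Γ ⊥' _ _ Γ⇒α₀ = Γ⇒α₀ , tt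
proposition3p10 𝒮 Γ (_ ∨' _) harrop _ _ = ⊥-elim (∨-not-Harrop harrop)
proposition3p10 𝒮 Γ (α ⊃ β) harrop (modusPonens ∷ 𝒞β) Γ⇒α⊃β =
  Γ⇒α⊃β , λ bar-α →
    proposition3p10 𝒮 Γ β (Harrop-⊃ harrop) 𝒞β
      (cut₂ (proj₁ bar-α) Γ⇒α⊃β (id-base modusPonens))
proposition3p10 𝒮 Γ (α ∧' β) harrop (proj-α ∷ proj-β ∷ 𝒞α𝒞β) Γ⇒α∧β =
  Γ⇒α∧β
  , proposition3p10 𝒮 Γ α (Harrop-∧₀ harrop) (++⁻ˡ (𝒞 α) 𝒞α𝒞β)
      (cut₁ Γ⇒α∧β (id-base proj-α))
  , proposition3p10 𝒮 Γ β (Harrop-∧₁ harrop) (++⁻ʳ (𝒞 α) 𝒞α𝒞β)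
      (cut₁ Γ⇒α∧β (id-base proj-β))
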